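{- Let $\Sigma_1=(X_1,X_{1,0},S_1,U,\to_1,Y,h_1)$ and $\Sigma_2=(X_2,X_{2,0},S_2,U,\to_2,Y,h_2)$ be NTSs with common input set $U$ and output set $Y$. Suppose there exists an InitSOP bisimulation relation $\sim\subseteq X_1\times X_2$ between $\Sigma_1$ and $\Sigma_2$. Then $\Sigma_1$ is initial-state opaque if and only if $\Sigma_2$ is initial-state opaque.
   Context: A nondeterministic transition system (NTS) is a tuple $\Sigma=(X,X_0,S,U,\to,Y,h)$, where $X$ is a (possibly infinite) set of states, $X_0\subseteq X$ the initial states, $S\subseteq X$ the secret states, $U$ a (possibly infinite) set of inputs, $\to\subseteq X\times U\times X$ the transition relation (write $x\xrightarrow{u}x'$ for $(x,u,x')\in\to$), $Y$ a set of outputs and $h:X\to Y$ the output map. $U^*$ is the set of finite sequences $\alpha=\alpha(0)\cdots\alpha(|\alpha|-1)$ over $U$, including the empty one. For $\alpha\in U^*$, a run over $\alpha$ is a nonempty sequence of states $x_0x_1\dots x_k$ with $k\le|\alpha|$, $x_0\in X_0$ and $(x_j,\alpha(j),x_{j+1})\in\to$ for all $j\in\{0,\dots,k-1\}$; it is maximal if $k=|\alpha|$ or there is no $x'$ with $(x_k,\alpha(k),x')\in\to$. $\Sigma$ is initial-state opaque if for every $\alpha\in U^*$ and every maximal run $x_0\dots x_k$ over $\alpha$ with $x_0\in X_0\cap S$, there is a maximal run $x_0'\dots x_k'$ over $\alpha$ with $x_0'\notin S$ and $h(x_j)=h(x_j')$ for all $j\in\{0,\dots,k\}$. A relation $\sim\subseteq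 X_1\times X_2$ is an InitSOP bisimulation relation between $\Sigma_1$ and $\Sigma_2$ if: (1a) for every $x_{1,0}\in X_{1,0}\cap S_1$ there is $x_{2,0}\in X_{2,0}\cap S_2$ with $(x_{1,0},x_{2,0})\in\sim$; (1b) for every $x_{1,0}\in X_{1,0}\setminus S_1$ there is $x_{2,0}\in X_{2,0}\setminus S_2$ with $(x_{1,0},x_{2,0})\in\sim$; (1c) for every $x_{2,0}\in X_{2,0}\cap S_2$ there is $x_{1,0}\in X_{1,0}\cap S_1$ with $(x_{1,0},x_{2,0})\in\sim$; (1d) for every $x_{2,0}\in X_{2,0}\setminus S_2$ there is $x_{1,0}\in X_{1,0}\setminus S_1$ with $(x_{1,0},x_{2,0})\in\sim$; (2) $h_1(x_1)=h_2(x_2)$ for all $(x_1,x_2)\in\sim$; (3a) for every $(x_1,x_2)\in\sim$ and every transition $x_1\xrightarrow{u}_1x_1'$ there is a transition $x_2\xrightarrow{u}_2x_2'$ (same input $u$) with $(x_1',x_2')\in\sim$; (3b) for every $(x_1,x_2)\in\sim$ and every transition $x_2\xrightarrow{u}_2x_2'$ there is a transition $x_1\xrightarrow{u}_1x_1'$ with $(x_1',x_2')\in\sim$. -}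

module Defs where

open import Level using (Level; _⊔_; suc)
open import Data.Nat using (ℕ; _<_; _≤_; s≤s)
open import Data.Nat.Properties using (<-≤-trans; m<n⇒m<1+n; n<1+n; ≤-refl)
open import Data.Fin using (Fin; fromℕ<)
open import Data.List using (List; length; lookup)
open import Data.Product using (Σ; ∃; _×_; _,_)
open import Data.Sum using (_⊎_)
open import Relation.Nullary using (¬_)
open import Relation.Binary.PropositionalEquality using (_≡_)

record NTS (ℓ : Level) (U Y : Set ℓ) : Set (suc ℓ) where
  field
    X     : Set ℓ
    X₀    : X → Set ℓ
    S     : X → Set ℓ
    Trans : X → U → X → Set ℓ
    h     : X → Y

module _ {ℓ : Level} {U Y : Set ℓ} (Σ' : NTS ℓ U Y) where
  open NTS Σ'

  record Run (α : List U) : Set ℓ where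
    field
      k      : ℕ
      k≤len  : k ≤ length α
      st     : Fin (ℕ.suc k) → X
      init   : X₀ (st (fromℕ< (s≤s (Data.Nat.z≤n))))
      step   : (j : ℕ) (p : j < k) →
               Trans (st (fromℕ< (m<n⇒m<1+n p)))
                     (lookup α (fromℕ< (<-≤-trans p k≤len)))
                     (st (fromℕ< (s≤s p)))

    first : X
    first = st (fromℕ< (s≤s (Data.Nat.z≤n)))
    last : X
    last = st (fromℕ< (n<1+n k))

  open Run public

  Maximal : {α : List U} → Run α → Set ℓ
  Maximal {α} r =
    (k r ≡ length α) ⊎
    (Σ (k r < length α) λ p →
       ¬ (Σ X λ x' → Trans (last r) (lookup α (fromℕ< p)) x'))

  InitialStateOpaque : Set ℓ
  InitialStateOpaque =
    (α : List U) (r : Run α) → Maximal r → S (first r) →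
    Σ (Run α) λ r' → Maximal r' × ¬ S (first r') ×
      Σ (k r' ≡ k r) λ eq →
        (j : ℕ) (p : j < ℕ.suc (k r)) →
          h (st r (fromℕ< p)) ≡ h (st r' (fromℕ< (Data.Nat.Properties.≤-trans p (s≤s (Data.Nat.Properties.≤-reflexive (Relation.Binary.PropositionalEquality.sym eq))))))

record IsInitSOPBisim {ℓ : Level} {U Y : Set ℓ} (Σ₁ Σ₂ : NTS ℓ U Y)
       (R : NTS.X Σ₁ → NTS.X Σ₂ → Set ℓ) : Set ℓ where
  module A = NTS Σ₁
  module B = NTS Σ₂
  field
    init-secret₁    : ∀ x₁ → A.X₀ x₁ → A.S x₁ →
                      Σ B.X λ x₂ → B.X₀ x₂ × B.S x₂ × R x₁ x₂
    init-nonsecret₁ : ∀ x₁ → A.X₀ x₁ → ¬ A.S x₁ →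
                      Σ B.X λ x₂ → B.X₀ x₂ × ¬ B.S x₂ × R x₁ x₂
    init-secret₂    : ∀ x₂ → B.X₀ x₂ → B.S x₂ →
                      Σ A.X λ x₁ → A.X₀ x₁ × A.S x₁ × R x₁ x₂
    init-nonsecret₂ : ∀ x₂ → B.X₀ x₂ → ¬ B.S x₂ →
                      Σ A.X λ x₁ → A.X₀ x₁ × ¬ A.S x₁ × R x₁ x₂
    output          : ∀ x₁ x₂ → R x₁ x₂ → A.h x₁ ≡ B.h x₂
    forth           : ∀ x₁ x₂ → R x₁ x₂ → ∀ u x₁' → A.Trans x₁ u x₁' →
                      Σ B.X λ x₂' → B.Trans x₂ u x₂' × R x₁' x₂'
    back            : ∀ x₁ x₂ → R x₁ x₂ → ∀ u x₂' → B.Trans x₂ u x₂' →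
                      Σ A.X λ x₁' → A.Trans x₁ u x₁' × R x₁' x₂'

module Submission where

-- The proof transports runs along the relation.  The core fact is a lifting
-- lemma: if R is a (plain, input-preserving) bisimulation, then every run of
-- Σ₁ can be replayed step by step, via the "forth" clause, from any initial
-- state of Σ₂ related to its first state; the replayed run has the same
-- length, is related to the original pointwise, and is maximal whenever the
-- original is (a missing successor in Σ₂ would give one in Σ₁ by "back").
-- Pointwise related runs produce the same output sequence, and "same output
-- sequence" is transitive.  Given a maximal secret run of Σ₂ we
-- lift it to a secret run of Σ₁, use opacity of Σ₁ to get an indistinguishable
-- non-secret run, and lift that back to Σ₂.  This direction uses only half of
-- the initial-state conditions (1a)-(1d); the theorem applies it to R and to
-- its converse.

open import Defs
open import Level using (Level)
open import Data.Product using (Σ; _,_; proj₁; proj₂; _×_)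
open import Function.Bundles using (_⇔_; mk⇔; Equivalence)
open import Data.Nat using (ℕ; zero; suc; _<_; s≤s; s<s⁻¹; _<?_)
open import Data.Nat.Properties using (n<1+n; m<n⇒m<1+n; <-≤-trans)
open import Data.Fin using (Fin; toℕ; fromℕ<)
open import Data.Fin.Properties using (toℕ-fromℕ<; toℕ<n)
open import Data.Sum using (inj₁; inj₂)
open import Data.List using (List; lookup)
open import Relation.Nullary using (¬_)
open import Relation.Nullary.Decidable using (recompute)
open import Relation.Binary.PropositionalEquality using (_≡_; refl; sym; trans; subst; subst₂)

module _ {ℓ : Level} {U Y : Set ℓ} where

  open NTS

  record IsBisimulation (Σ₁ Σ₂ : NTS ℓ U Y) (R : X Σ₁ → X Σ₂ → Set ℓ) : Set ℓ where
    field
      output : ∀ {x y} → R x y → h Σ₁ x ≡ h Σ₂ y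
      forth  : ∀ {x y} → R x y → ∀ {u x'} → Trans Σ₁ x u x' →
               Σ (X Σ₂) λ y' → Trans Σ₂ y u y' × R x' y'
      back   : ∀ {x y} → R x y → ∀ {u y'} → Trans Σ₂ y u y' →
               Σ (X Σ₁) λ x' → Trans Σ₁ x u x' × R x' y'

  underlying : {Σ₁ Σ₂ : NTS ℓ U Y} {R : X Σ₁ → X Σ₂ → Set ℓ} →
               IsInitSOPBisim Σ₁ Σ₂ R → IsBisimulation Σ₁ Σ₂ R
  underlying B = record
    { output = λ rel → I.output _ _ rel
    ; forth  = λ rel t → I.forth _ _ rel _ _ t
    ; back   = λ rel t → I.back _ _ rel _ _ t
    }
    where module I = IsInitSOPBisim B

  converse : {Σ₁ Σ₂ : NTS ℓ U Y} {R : X Σ₁ → X Σ₂ → Set ℓ} →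
             IsBisimulation Σ₁ Σ₂ R → IsBisimulation Σ₂ Σ₁ (λ y x → R x y)
  converse B = record
    { output = λ rel → sym (output rel)
    ; forth  = back
    ; back   = forth
    }
    where open IsBisimulation B

  -- Two runs over α have the same length and produce the same outputs.
  -- The bounds p, q only enter through the proof-irrelevant argument of fromℕ<.
  record SameOutputs {Σ₁ Σ₂ : NTS ℓ U Y} {α : List U} (r : Run Σ₁ α) (r' : Run Σ₂ α) : Set ℓ where
    constructor sameOutputs
    field
      length-eq : k r' ≡ k r
      outputs   : ∀ j (p : j < suc (k r)) (q : j < suc (k r')) →
                  h Σ₁ (st r (fromℕ< p)) ≡ h Σ₂ (st r' (fromℕ< q))

  sameOutputs-trans : {Σ₁ Σ₂ Σ₃ : NTS ℓ U Y} {α : List U}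
                      {r₁ : Run Σ₁ α} {r₂ : Run Σ₂ α} {r₃ : Run Σ₃ α} →
                      SameOutputs r₁ r₂ → SameOutputs r₂ r₃ → SameOutputs r₁ r₃
  sameOutputs-trans {r₁ = r₁} {r₂} (sameOutputs eq₁₂ outs₁₂) (sameOutputs eq₂₃ outs₂₃) =
    sameOutputs (trans eq₂₃ eq₁₂) λ j p q → trans (outs₁₂ j p (middle j p)) (outs₂₃ j (middle j p) q)
    where
    middle : ∀ j → j < suc (k r₁) → j < suc (k r₂)
    middle j p = subst (λ n → j < suc n) (sym eq₁₂) p

  Opaque : NTS ℓ U Y → Set ℓ
  Opaque Σ' =
    (α : List U) (r : Run Σ' α) → Maximal Σ' r → S Σ' (first r) →
    Σ (Run Σ' α) λ r' → Maximal Σ' r' × ¬ S Σ' (first r') × SameOutputs r r'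

  opaque⇔ : (Σ' : NTS ℓ U Y) → InitialStateOpaque Σ' ⇔ Opaque Σ'
  opaque⇔ Σ' = mk⇔ to from
    where
    to : InitialStateOpaque Σ' → Opaque Σ'
    to op α r max sec with op α r max sec
    ... | r' , max' , nsec' , eq , outs = r' , max' , nsec' , sameOutputs eq λ j p _ → outs j p
    from : Opaque Σ' → InitialStateOpaque Σ'
    from op α r max sec with op α r max sec
    ... | r' , max' , nsec' , sameOutputs eq outs = r' , max' , nsec' , eq , λ j p → outs j p (subst (λ n → j < suc n) (sym eq) p)

  module Lift {Σ₁ Σ₂ : NTS ℓ U Y} {R : X Σ₁ → X Σ₂ → Set ℓ}
              (B : IsBisimulation Σ₁ Σ₂ R) {α : List U} (r : Run Σ₁ α)
              (y₀ : X Σ₂) (y₀-initial : X₀ Σ₂ y₀) (y₀-related : R (first r) y₀) where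

    open IsBisimulation B

    Partner : ∀ j → .(j < suc (k r)) → Set ℓ
    Partner j p = Σ (X Σ₂) λ y → R (st r (fromℕ< p)) y

    advance : ∀ j (q : j < k r) → Partner j (m<n⇒m<1+n q) → Partner (suc j) (s≤s q)
    advance j q (_ , rel) = let (y' , _ , rel') = forth rel (step r j q) in y' , rel'

    advance-step : ∀ j (q : j < k r) (s : Partner j (m<n⇒m<1+n q)) →
                   Trans Σ₂ (proj₁ s) (lookup α (fromℕ< (<-≤-trans q (k≤len r)))) (proj₁ (advance j q s))
    advance-step j q (_ , rel) = proj₁ (proj₂ (forth rel (step r j q)))

    -- Partners of all states of r, built along the run.  The bound is taken
    -- irrelevantly (and recomputed where a step of r needs it), so the
    -- partner depends on the position j alone.
    partner : ∀ j .(p : j < suc (k r)) → Partner j p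
    partner zero    _ = y₀ , y₀-related
    partner (suc j) p = advance j (recompute (j <? k r) (s<s⁻¹ p)) (partner j _)

    partner-cong : ∀ {j j'} → j ≡ j' → .(p : j < suc (k r)) .(p' : j' < suc (k r)) →
                   proj₁ (partner j p) ≡ proj₁ (partner j' p')
    partner-cong refl _ _ = refl

    states : Fin (suc (k r)) → X Σ₂
    states i = proj₁ (partner (toℕ i) (toℕ<n i))

    states-at : ∀ j .(p : j < suc (k r)) → states (fromℕ< p) ≡ proj₁ (partner j p)
    states-at j p = partner-cong (toℕ-fromℕ< p) _ p

    lifted : Run Σ₂ α
    lifted = record
      { k     = k r
      ; k≤len = k≤len r
      ; st    = states
      ; init  = y₀-initial
      ; step  = λ j q →
          subst₂ (λ y y' → Trans Σ₂ y _ y') (sym (states-at j (m<n⇒m<1+n q))) (sym (states-at (suc j) (s≤s q)))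
                 (advance-step j (recompute (j <? k r) q) (partner j _))
      }

    related : ∀ j (p : j < suc (k r)) (q : j < suc (k r)) →
              R (st r (fromℕ< p)) (st lifted (fromℕ< q))
    related j p q = subst (R _) (sym (states-at j q)) (proj₂ (partner j q))

    same : SameOutputs r lifted
    same = sameOutputs refl λ j p q → output (related j p q)

    -- If the lifted run could be extended, "back" would extend r as well.
    maximal : Maximal Σ₁ r → Maximal Σ₂ lifted
    maximal (inj₁ full)          = inj₁ full
    maximal (inj₂ (p , blocked)) = inj₂ (p , λ (y' , t) →
      let (x' , t' , _) = back (related (k r) (n<1+n _) (n<1+n _)) t in blocked (x' , t'))

  opacity-transfer :
    {Σ₁ Σ₂ : NTS ℓ U Y} {R : X Σ₁ → X Σ₂ → Set ℓ} → IsBisimulation Σ₁ Σ₂ R →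
    (∀ y → X₀ Σ₂ y → S Σ₂ y → Σ (X Σ₁) λ x → X₀ Σ₁ x × S Σ₁ x × R x y) →
    (∀ x → X₀ Σ₁ x → ¬ S Σ₁ x → Σ (X Σ₂) λ y → X₀ Σ₂ y × ¬ S Σ₂ y × R x y) →
    Opaque Σ₁ → Opaque Σ₂
  opacity-transfer B secret₂ nonsecret₁ opaque₁ α r₂ max₂ sec₂ =
    let (x , x-init , x-sec , x-rel) = secret₂ (first r₂) (init r₂) sec₂
        module Down = Lift (converse B) r₂ x x-init x-rel
        (r₁ , max₁ , nsec₁ , same₁) = opaque₁ α Down.lifted (Down.maximal max₂) x-sec
        (y , y-init , y-nsec , y-rel) = nonsecret₁ (first r₁) (init r₁) nsec₁
        module Up = Lift B r₁ y y-init y-rel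
    in Up.lifted , Up.maximal max₁ , y-nsec ,
       sameOutputs-trans Down.same (sameOutputs-trans same₁ Up.same)

theorem3p14 : {ℓ : Level} {U Y : Set ℓ} (Σ₁ Σ₂ : NTS ℓ U Y) →
              Σ (NTS.X Σ₁ → NTS.X Σ₂ → Set ℓ) (IsInitSOPBisim Σ₁ Σ₂) →
              InitialStateOpaque Σ₁ ⇔ InitialStateOpaque Σ₂
theorem3p14 Σ₁ Σ₂ (R , B) =
  mk⇔ (λ op₁ → from (opaque⇔ Σ₂) (forward (to (opaque⇔ Σ₁) op₁)))
      (λ op₂ → from (opaque⇔ Σ₁) (backward (to (opaque⇔ Σ₂) op₂)))
  where
  open IsInitSOPBisim B
  open Equivalence
  forward  : Opaque Σ₁ → Opaque Σ₂
  forward  = opacity-transfer (underlying B) init-secret₂ init-nonsecret₁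
  backward : Opaque Σ₂ → Opaque Σ₁
  backward = opacity-transfer (converse (underlying B)) init-secret₁ init-nonsecret₂
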